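{- Consider an access to $s$ by a minimally self-adjusting BST algorithm, with tree $T$ before and $T'$ after the access, and search path $P$. Let $a,b\in P$ with $s<a<b$, $a$ a proper descendant of $b$ in $P$, and $\{a,b\}$ monotone. Then $T'(a)\subseteq T(b)$.
   Context: For a BST $T$ and node $a$, $T(a)$ is the set of keys in the subtree rooted at $a$. A minimally self-adjusting BST algorithm, on access to $s$ in $T$ with search path $P$ (nodes on the root-to-$s$ path including $s$), replaces $P$ by a BST $A$ on node set $P$ with root $s$ (the after-tree), reattaching the subtrees hanging off $P$ in the unique order-consistent way, producing $T'$. A subset $X\subseteq P$ is monotone if either all its elements are larger than $s$ and have the same right-depth in $A$, or all are smaller than $s$ and have the same left-depth in $A$ (right-/left-depth: number of right-/left-going edges on the root-to-node path). -}

module Defs where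

open import Data.Nat using (ℕ; zero; suc; _<_; _<ᵇ_)
open import Data.Bool using (if_then_else_)
open import Data.List using (List; []; _∷_; _++_)
open import Data.Product using (_×_; _,_; proj₁; ∃)
open import Data.Sum using (_⊎_)
open import Data.List.Relation.Unary.All using (All)

data Tree : Set where
  leaf : Tree
  node : Tree → ℕ → Tree → Tree

inorder : Tree → List ℕ
inorder leaf = []
inorder (node l k r) = inorder l ++ (k ∷ inorder r)

data _∈T_ (x : ℕ) : Tree → Set where
  here  : ∀ {l r} → x ∈T node l x r
  left  : ∀ {l k r} → x ∈T l → x ∈T node l k r
  right : ∀ {l k r} → x ∈T r → x ∈T node l k r

open import Data.List.Relation.Unary.Linked using (Linked)
IsBST : Tree → Set
IsBST t = Linked _<_ (inorder t)

data RootIs (s : ℕ) : Tree → Set where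
  root : ∀ {l r} → RootIs s (node l s r)

-- SubAt a T U : U is the subtree of T rooted at the node with key a  (U = T(a) as a tree).
data SubAt (a : ℕ) : Tree → Tree → Set where
  here  : ∀ {l r} → SubAt a (node l a r) (node l a r)
  left  : ∀ {l k r U} → SubAt a l U → SubAt a (node l k r) U
  right : ∀ {l k r U} → SubAt a r U → SubAt a (node l k r) U

path : ℕ → Tree → List ℕ
path s leaf = []
path s (node l k r) =
  if s <ᵇ k then k ∷ path s l
  else (if k <ᵇ s then k ∷ path s r else k ∷ [])

-- Subtrees hanging off the search path, in left-to-right (in-order) order.
hang : ℕ → Tree → List Tree
hang s leaf = leaf ∷ []
hang s (node l k r) =
  if s <ᵇ k then hang s l ++ (r ∷ [])
  else (if k <ᵇ s then l ∷ hang s r else l ∷ r ∷ [])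

fill : Tree → List Tree → Tree × List Tree
fill leaf [] = leaf , []
fill leaf (t ∷ ts) = t , ts
fill (node l k r) ts with fill l ts
... | l' , ts₁ with fill r ts₁
... | r' , ts₂ = node l' k r' , ts₂

-- The tree after access: after-tree A with hanging subtrees of T reattached.
after : ℕ → Tree → Tree → Tree
after s T A = proj₁ (fill A (hang s T))

data RDepth (x : ℕ) : Tree → ℕ → Set where
  here  : ∀ {l r} → RDepth x (node l x r) 0
  left  : ∀ {l k r d} → RDepth x l d → RDepth x (node l k r) d
  right : ∀ {l k r d} → RDepth x r d → RDepth x (node l k r) (suc d)

data LDepth (x : ℕ) : Tree → ℕ → Set where
  here  : ∀ {l r} → LDepth x (node l x r) 0
  left  : ∀ {l k r d} → LDepth x l d → LDepth x (node l k r) (suc d)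
  right : ∀ {l k r d} → LDepth x r d → LDepth x (node l k r) d

Monotone : ℕ → Tree → List ℕ → Set
Monotone s A X =
  (All (s <_) X × ∃ λ d → All (λ x → RDepth x A d) X)
  ⊎ (All (_< s) X × ∃ λ d → All (λ x → LDepth x A d) X)

module Submission where

-- Write T' = after s T A.  Reattaching the hanging subtrees in
-- order-consistent fashion does not change the in-order key sequence:
-- inorder T is the interleaving of the hanging subtrees (hang s T) with the
-- search path sorted (spath s T), inorder A is that same sorted path (both are
-- sorted permutations of path s T), and filling the leaves of A with the
-- hanging subtrees produces exactly this interleaving.  So T' is a BST with the
-- key set of T, and A survives inside T' with its leaves replaced (A ⊑ T').
-- Now let x ∈ T'(a).
--   * s < x:  a > s lies in the right subtree of the root s of A, hence of T'.
--   * x < b:  a and b have the same right-depth in A, so their lowest common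
--     ancestor c ≤ b has a in its left subtree, in A and hence in T'.
--   * s ∈ T(b), because b lies on the search path of s.
-- The keys of T(b) form an interval among those of T, so x ∈ T(b).

open import Defs
open import Data.Nat using (ℕ; _<_; _≤_; _<ᵇ_)
open import Data.Nat.Properties
  using (<-irrefl; <-asym; <-trans; <⇒≤; ≤-refl; <-≤-trans; <ᵇ⇒<; ≤-totalOrder)
open import Data.Bool using (true; false; if_then_else_)
open import Data.Unit using (tt)
open import Data.Empty using (⊥-elim)
open import Data.Sum using (inj₁; inj₂)
open import Data.Product using (_×_; ∃; ∃₂; _,_; proj₁; proj₂)
open import Data.List using (List; []; _∷_; _++_)
open import Data.List.Properties using (++-assoc; ++-identityʳ)
open import Data.List.Relation.Unary.Any using (here; there)
open import Data.List.Relation.Unary.All as All using (All; _∷_)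
import Data.List.Relation.Unary.All.Properties as All
open import Data.List.Relation.Unary.AllPairs using (AllPairs; []; _∷_)
import Data.List.Relation.Unary.Linked as Linked
open import Data.List.Relation.Unary.Linked.Properties using (Linked⇒AllPairs; AllPairs⇒Linked)
open import Data.List.Relation.Unary.Sorted.TotalOrder.Properties using (↗↭↗⇒≋)
open import Data.List.Relation.Binary.Pointwise using (Pointwise-≡⇒≡)
open import Data.List.Relation.Binary.Sublist.Propositional using (_⊆_; []; _∷_; _∷ʳ_; minimum)
open import Data.List.Relation.Binary.Sublist.Propositional.Properties using (All-resp-⊆)
open import Data.List.Relation.Binary.Sublist.Heterogeneous.Properties using (++ˡ)
open import Data.List.Membership.Propositional.Properties using (∈-++⁺ˡ; ∈-++⁺ʳ; ∈-++⁻)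
open import Data.List.Membership.Propositional using (_∈_)
open import Data.List.Relation.Binary.Permutation.Propositional
  using (_↭_; prep; ↭-sym; ↭-trans; ↭-refl; ↭⇒↭ₛ)
import Data.List.Relation.Binary.Permutation.Propositional.Properties as Perm
open import Relation.Binary.PropositionalEquality using (_≡_; refl; sym; subst; cong₂)

AllPairs-++⁻ : {A : Set} {R : A → A → Set} (xs : List A) {ys : List A} →
  AllPairs R (xs ++ ys) →
  AllPairs R xs × AllPairs R ys × All (λ x → All (R x) ys) xs
AllPairs-++⁻ [] rys = [] , rys , All.[]
AllPairs-++⁻ (x ∷ xs) (rx ∷ rxsys) with AllPairs-++⁻ xs rxsys
... | rxs , rys , rxys = All.++⁻ˡ xs rx ∷ rxs , rys , All.++⁻ʳ xs rx ∷ rxys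

AllPairs-resp-⊆ : {A : Set} {R : A → A → Set} {xs ys : List A} →
  xs ⊆ ys → AllPairs R ys → AllPairs R xs
AllPairs-resp-⊆ [] [] = []
AllPairs-resp-⊆ (y ∷ʳ sub) (_ ∷ rys) = AllPairs-resp-⊆ sub rys
AllPairs-resp-⊆ (refl ∷ sub) (ry ∷ rys) = All-resp-⊆ sub ry ∷ AllPairs-resp-⊆ sub rys

increasing-unique : {xs ys : List ℕ} →
  AllPairs _<_ xs → AllPairs _<_ ys → xs ↭ ys → xs ≡ ys
increasing-unique xs< ys< xs↭ys =
  Pointwise-≡⇒≡ (↗↭↗⇒≋ ≤-totalOrder (increasing xs<) (increasing ys<) (↭⇒↭ₛ xs↭ys))
  where
    increasing : {zs : List ℕ} → AllPairs _<_ zs → Linked.Linked _≤_ zs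
    increasing zs< = Linked.map <⇒≤ (AllPairs⇒Linked zs<)

-- A tree is ordered when its in-order key sequence is strictly increasing;
-- this is IsBST in the pairwise form, which is convenient for splitting.
-- (A record, so that the tree can be inferred from an ordering proof.)
record Ordered (t : Tree) : Set where
  constructor ordered
  field increasing : AllPairs _<_ (inorder t)

IsBST⇒Ordered : {t : Tree} → IsBST t → Ordered t
IsBST⇒Ordered bst = ordered (Linked⇒AllPairs <-trans bst)

∈T⇒∈inorder : {x : ℕ} {t : Tree} → x ∈T t → x ∈ inorder t
∈T⇒∈inorder {t = node l k r} here = ∈-++⁺ʳ (inorder l) (here refl)
∈T⇒∈inorder (left m) = ∈-++⁺ˡ (∈T⇒∈inorder m)
∈T⇒∈inorder {t = node l k r} (right m) = ∈-++⁺ʳ (inorder l) (there (∈T⇒∈inorder m))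

∈inorder⇒∈T : {x : ℕ} (t : Tree) → x ∈ inorder t → x ∈T t
∈inorder⇒∈T (node l k r) m with ∈-++⁻ (inorder l) m
... | inj₁ m-l = left (∈inorder⇒∈T l m-l)
... | inj₂ (here refl) = here
... | inj₂ (there m-r) = right (∈inorder⇒∈T r m-r)

module _ {l r : Tree} {k : ℕ} (ord : Ordered (node l k r)) where

  private
    parts : AllPairs _<_ (inorder l) × AllPairs _<_ (k ∷ inorder r) ×
            All (λ x → All (x <_) (k ∷ inorder r)) (inorder l)
    parts = AllPairs-++⁻ (inorder l) (Ordered.increasing ord)

  ordered-left : Ordered l
  ordered-left = ordered (proj₁ parts)

  ordered-right : Ordered r
  ordered-right with proj₁ (proj₂ parts)
  ... | _ ∷ r-ord = ordered r-ord

  below-root : {x : ℕ} → x ∈T l → x < k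
  below-root m with All.lookup (proj₂ (proj₂ parts)) (∈T⇒∈inorder m)
  ... | x<k ∷ _ = x<k

  above-root : {x : ℕ} → x ∈T r → k < x
  above-root m with proj₁ (proj₂ parts)
  ... | k<r ∷ _ = All.lookup k<r (∈T⇒∈inorder m)

  descend-left : {x : ℕ} → x ∈T node l k r → x < k → x ∈T l
  descend-left here x<k = ⊥-elim (<-irrefl refl x<k)
  descend-left (left m) _ = m
  descend-left (right m) x<k = ⊥-elim (<-asym x<k (above-root m))

  descend-right : {x : ℕ} → x ∈T node l k r → k < x → x ∈T r
  descend-right here k<x = ⊥-elim (<-irrefl refl k<x)
  descend-right (left m) k<x = ⊥-elim (<-asym k<x (below-root m))
  descend-right (right m) _ = m

subtree-⊆ : {a x : ℕ} {t U : Tree} → SubAt a t U → x ∈T U → x ∈T t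
subtree-⊆ here m = m
subtree-⊆ (left sub) m = left (subtree-⊆ sub m)
subtree-⊆ (right sub) m = right (subtree-⊆ sub m)

subtree-root : {a : ℕ} {t U : Tree} → SubAt a t U → a ∈T U
subtree-root here = here
subtree-root (left sub) = subtree-root sub
subtree-root (right sub) = subtree-root sub

subtree-key : {a : ℕ} {t U : Tree} → SubAt a t U → a ∈T t
subtree-key sub = subtree-⊆ sub (subtree-root sub)

subtree-exists : {a : ℕ} {t : Tree} → a ∈T t → ∃ λ U → SubAt a t U
subtree-exists here = _ , here
subtree-exists (left m) with subtree-exists m
... | U , sub = U , left sub
subtree-exists (right m) with subtree-exists m
... | U , sub = U , right sub

subtree-trans : {a c : ℕ} {t V U : Tree} → SubAt c t V → SubAt a V U → SubAt a t U
subtree-trans here sub = sub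
subtree-trans (left sub₁) sub = left (subtree-trans sub₁ sub)
subtree-trans (right sub₁) sub = right (subtree-trans sub₁ sub)

subtree-ordered : {a : ℕ} {t U : Tree} → Ordered t → SubAt a t U → Ordered U
subtree-ordered ord here = ord
subtree-ordered ord (left sub) = subtree-ordered (ordered-left ord) sub
subtree-ordered ord (right sub) = subtree-ordered (ordered-right ord) sub

-- Keys of an ordered tree are distinct, so t(a) is well defined.
subtree-unique : {a : ℕ} {t U V : Tree} → Ordered t → SubAt a t U → SubAt a t V → U ≡ V
subtree-unique ord here here = refl
subtree-unique ord here (left sub) = ⊥-elim (<-irrefl refl (below-root ord (subtree-key sub)))
subtree-unique ord here (right sub) = ⊥-elim (<-irrefl refl (above-root ord (subtree-key sub)))
subtree-unique ord (left sub) here = ⊥-elim (<-irrefl refl (below-root ord (subtree-key sub)))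
subtree-unique ord (left sub) (left sub') = subtree-unique (ordered-left ord) sub sub'
subtree-unique ord (left sub) (right sub') =
  ⊥-elim (<-asym (below-root ord (subtree-key sub)) (above-root ord (subtree-key sub')))
subtree-unique ord (right sub) here = ⊥-elim (<-irrefl refl (above-root ord (subtree-key sub)))
subtree-unique ord (right sub) (left sub') =
  ⊥-elim (<-asym (below-root ord (subtree-key sub')) (above-root ord (subtree-key sub)))
subtree-unique ord (right sub) (right sub') = subtree-unique (ordered-right ord) sub sub'

left-descendant-below : {a c x : ℕ} {t l r U : Tree} → Ordered t →
  SubAt c t (node l c r) → a ∈T l → SubAt a t U → x ∈T U → x < c
left-descendant-below ord t-c a∈l t-a x∈U with subtree-exists a∈l
... | _ , l-a rewrite subtree-unique ord t-a (subtree-trans t-c (left l-a)) =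
  below-root (subtree-ordered ord t-c) (subtree-⊆ l-a x∈U)

right-descendant-above : {a c x : ℕ} {t l r U : Tree} → Ordered t →
  SubAt c t (node l c r) → a ∈T r → SubAt a t U → x ∈T U → c < x
right-descendant-above ord t-c a∈r t-a x∈U with subtree-exists a∈r
... | _ , r-a rewrite subtree-unique ord t-a (subtree-trans t-c (right r-a)) =
  above-root (subtree-ordered ord t-c) (subtree-⊆ r-a x∈U)

-- The keys of t(b) form an interval among the keys of t: every key of t
-- strictly between a key of t(b) and b belongs to t(b).
subtree-convex : {b x y : ℕ} {t U : Tree} → Ordered t → SubAt b t U →
  y ∈T U → x ∈T t → y < x → x < b → x ∈T U
subtree-convex ord here y∈U x∈t y<x x<b = x∈t
subtree-convex ord (left sub) y∈U here y<x x<b =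
  ⊥-elim (<-asym x<b (below-root ord (subtree-key sub)))
subtree-convex ord (left sub) y∈U (left x∈l) y<x x<b =
  subtree-convex (ordered-left ord) sub y∈U x∈l y<x x<b
subtree-convex ord (left sub) y∈U (right x∈r) y<x x<b =
  ⊥-elim (<-asym (<-trans (above-root ord x∈r) x<b) (below-root ord (subtree-key sub)))
subtree-convex ord (right sub) y∈U here y<x x<b =
  ⊥-elim (<-asym y<x (above-root ord (subtree-⊆ sub y∈U)))
subtree-convex ord (right sub) y∈U (left x∈l) y<x x<b =
  ⊥-elim (<-asym (<-trans y<x (below-root ord x∈l)) (above-root ord (subtree-⊆ sub y∈U)))
subtree-convex ord (right sub) y∈U (right x∈r) y<x x<b =
  subtree-convex (ordered-right ord) sub y∈U x∈r y<x x<b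

search-path-subtree-exists : {s b : ℕ} (t : Tree) → Ordered t → s ∈T t →
  b ∈ path s t → ∃ λ U → SubAt b t U × s ∈T U
search-path-subtree-exists {s} (node l k r) ord s∈t b∈P with s <ᵇ k | <ᵇ⇒< s k
search-path-subtree-exists (node l k r) ord s∈t (here refl) | true | _ = _ , here , s∈t
search-path-subtree-exists (node l k r) ord s∈t (there b∈P) | true | s<k
  with search-path-subtree-exists l (ordered-left ord) (descend-left ord s∈t (s<k tt)) b∈P
... | U , sub , s∈U = U , left sub , s∈U
search-path-subtree-exists {s} (node l k r) ord s∈t b∈P | false | _ with k <ᵇ s | <ᵇ⇒< k s
search-path-subtree-exists (node l k r) ord s∈t (here refl) | false | _ | true | _ = _ , here , s∈t
search-path-subtree-exists (node l k r) ord s∈t (there b∈P) | false | _ | true | k<s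
  with search-path-subtree-exists r (ordered-right ord) (descend-right ord s∈t (k<s tt)) b∈P
... | U , sub , s∈U = U , right sub , s∈U
search-path-subtree-exists (node l k r) ord s∈t (here refl) | false | _ | false | _ = _ , here , s∈t

search-path-subtree : {s b : ℕ} {t U : Tree} → Ordered t → s ∈T t →
  b ∈ path s t → SubAt b t U → s ∈T U
search-path-subtree {t = t} ord s∈t b∈P t-b with search-path-subtree-exists t ord s∈t b∈P
... | V , t-b' , s∈V rewrite subtree-unique ord t-b t-b' = s∈V

-- The search path in increasing order, i.e. interleaved with hang s t.
spath : ℕ → Tree → List ℕ
spath s leaf = []
spath s (node l k r) =
  if s <ᵇ k then spath s l ++ (k ∷ [])
  else (if k <ᵇ s then k ∷ spath s r else k ∷ [])

spath↭path : (s : ℕ) (t : Tree) → spath s t ↭ path s t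
spath↭path s leaf = ↭-refl
spath↭path s (node l k r) with s <ᵇ k
... | true = ↭-trans (Perm.++-comm (spath s l) (k ∷ [])) (prep k (spath↭path s l))
... | false with k <ᵇ s
... | true = prep k (spath↭path s r)
... | false = ↭-refl

-- Interleaving ts ks zs: zs = inorder t₀ ++ k₀ ∷ inorder t₁ ++ … ++ kₙ₋₁ ∷ inorder tₙ
-- for trees ts = t₀ … tₙ and keys ks = k₀ … kₙ₋₁.
data Interleaving : List Tree → List ℕ → List ℕ → Set where
  last : (t : Tree) → Interleaving (t ∷ []) [] (inorder t)
  next : (t : Tree) (k : ℕ) {ts : List Tree} {ks zs : List ℕ} →
    Interleaving ts ks zs → Interleaving (t ∷ ts) (k ∷ ks) (inorder t ++ k ∷ zs)

interleaving-++ : {k : ℕ} {ts us : List Tree} {xs ys zs ws : List ℕ} →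
  Interleaving ts xs zs → Interleaving us ys ws →
  Interleaving (ts ++ us) (xs ++ k ∷ ys) (zs ++ k ∷ ws)
interleaving-++ (last t) q = next t _ q
interleaving-++ {k} {ws = ws} (next t k′ {zs = zs} p) q
  rewrite ++-assoc (inorder t) (k′ ∷ zs) (k ∷ ws) = next t k′ (interleaving-++ p q)

interleaving-split : {k : ℕ} (xs : List ℕ) {ys : List ℕ} {ts : List Tree} {zs : List ℕ} →
  Interleaving ts (xs ++ k ∷ ys) zs →
  ∃₂ λ ts₁ ts₂ → ∃₂ λ zs₁ zs₂ → ts ≡ ts₁ ++ ts₂ × zs ≡ zs₁ ++ k ∷ zs₂ ×
    Interleaving ts₁ xs zs₁ × Interleaving ts₂ ys zs₂
interleaving-split [] (next t k p) = t ∷ [] , _ , inorder t , _ , refl , refl , last t , p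
interleaving-split {k} (x ∷ xs) (next t x p) with interleaving-split xs p
... | ts₁ , ts₂ , zs₁ , zs₂ , refl , refl , p₁ , p₂ =
  t ∷ ts₁ , ts₂ , inorder t ++ x ∷ zs₁ , zs₂ , refl ,
  sym (++-assoc (inorder t) (x ∷ zs₁) (k ∷ zs₂)) , next t x p₁ , p₂

interleaving-⊆ : {ts : List Tree} {ks zs : List ℕ} → Interleaving ts ks zs → ks ⊆ zs
interleaving-⊆ (last t) = minimum (inorder t)
interleaving-⊆ (next t k p) = ++ˡ (inorder t) (refl ∷ interleaving-⊆ p)

hang-interleaving : (s : ℕ) (t : Tree) → Interleaving (hang s t) (spath s t) (inorder t)
hang-interleaving s leaf = last leaf
hang-interleaving s (node l k r) with s <ᵇ k
... | true = interleaving-++ (hang-interleaving s l) (last r)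
... | false with k <ᵇ s
... | true = next l k (hang-interleaving s r)
... | false = next l k (last r)

fill-interleaving : (A : Tree) {ts : List Tree} {zs : List ℕ} (rest : List Tree) →
  Interleaving ts (inorder A) zs →
  proj₂ (fill A (ts ++ rest)) ≡ rest × inorder (proj₁ (fill A (ts ++ rest))) ≡ zs
fill-interleaving leaf rest (last t) = refl , refl
fill-interleaving (node l k r) rest p with interleaving-split (inorder l) p
... | ts₁ , ts₂ , zs₁ , zs₂ , refl , refl , p₁ , p₂
  rewrite ++-assoc ts₁ ts₂ rest with fill-interleaving l (ts₂ ++ rest) p₁
... | rest-l , inorder-l rewrite rest-l with fill-interleaving r rest p₂
... | rest-r , inorder-r = rest-r , cong₂ (λ u v → u ++ k ∷ v) inorder-l inorder-r

after-inorder : (s : ℕ) (T A : Tree) → Ordered T → Ordered A → inorder A ↭ path s T →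
  inorder (after s T A) ≡ inorder T
after-inorder s T A ord-T ord-A A↭P =
  subst (λ ts → inorder (proj₁ (fill A ts)) ≡ inorder T) (++-identityʳ (hang s T))
    (proj₂ (fill-interleaving A [] woven))
  where
    spath-ordered : AllPairs _<_ (spath s T)
    spath-ordered = AllPairs-resp-⊆ (interleaving-⊆ (hang-interleaving s T))
      (Ordered.increasing ord-T)

    A≡spath : inorder A ≡ spath s T
    A≡spath = increasing-unique (Ordered.increasing ord-A) spath-ordered (↭-trans A↭P (↭-sym (spath↭path s T)))

    woven : Interleaving (hang s T) (inorder A) (inorder T)
    woven = subst (λ ks → Interleaving (hang s T) ks (inorder T)) (sym A≡spath)
      (hang-interleaving s T)

data _⊑_ : Tree → Tree → Set where
  ⊑-leaf : {t : Tree} → leaf ⊑ t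
  ⊑-node : {l r l′ r′ : Tree} {k : ℕ} → l ⊑ l′ → r ⊑ r′ → node l k r ⊑ node l′ k r′

fill-⊑ : (A : Tree) (ts : List Tree) → A ⊑ proj₁ (fill A ts)
fill-⊑ leaf ts = ⊑-leaf
fill-⊑ (node l k r) ts = ⊑-node (fill-⊑ l ts) (fill-⊑ r _)

⊑-∈ : {x : ℕ} {A A′ : Tree} → A ⊑ A′ → x ∈T A → x ∈T A′
⊑-∈ (⊑-node _ _) here = here
⊑-∈ (⊑-node l⊑ _) (left m) = left (⊑-∈ l⊑ m)
⊑-∈ (⊑-node _ r⊑) (right m) = right (⊑-∈ r⊑ m)

⊑-subtree : {c : ℕ} {A A′ l r : Tree} → A ⊑ A′ → SubAt c A (node l c r) →
  ∃₂ λ l′ r′ → SubAt c A′ (node l′ c r′) × l ⊑ l′ × r ⊑ r′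
⊑-subtree (⊑-node l⊑ r⊑) here = _ , _ , here , l⊑ , r⊑
⊑-subtree (⊑-node l⊑ _) (left sub) with ⊑-subtree l⊑ sub
... | l′ , r′ , sub′ , ext = l′ , r′ , left sub′ , ext
⊑-subtree (⊑-node _ r⊑) (right sub) with ⊑-subtree r⊑ sub
... | l′ , r′ , sub′ , ext = l′ , r′ , right sub′ , ext

rdepth-∈ : {x d : ℕ} {t : Tree} → RDepth x t d → x ∈T t
rdepth-∈ here = here
rdepth-∈ (left p) = left (rdepth-∈ p)
rdepth-∈ (right p) = right (rdepth-∈ p)

same-right-depth : {a b d : ℕ} {t : Tree} → Ordered t →
  RDepth a t d → RDepth b t d → a < b →
  ∃ λ c → c ≤ b × ∃₂ λ l r → SubAt c t (node l c r) × a ∈T l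
same-right-depth ord here here a<b = ⊥-elim (<-irrefl refl a<b)
same-right-depth ord here (left b-d) a<b = ⊥-elim (<-asym a<b (below-root ord (rdepth-∈ b-d)))
same-right-depth ord (left a-d) here a<b = _ , ≤-refl , _ , _ , here , rdepth-∈ a-d
same-right-depth ord (left a-d) (left b-d) a<b with same-right-depth (ordered-left ord) a-d b-d a<b
... | c , c≤b , l , r , sub , a∈l = c , c≤b , l , r , left sub , a∈l
same-right-depth ord (left a-d) (right b-d) a<b =
  _ , <⇒≤ (above-root ord (rdepth-∈ b-d)) , _ , _ , here , rdepth-∈ a-d
same-right-depth ord (right a-d) (left b-d) a<b =
  ⊥-elim (<-asym (<-trans (above-root ord (rdepth-∈ a-d)) a<b) (below-root ord (rdepth-∈ b-d)))
same-right-depth ord (right a-d) (right b-d) a<b with same-right-depth (ordered-right ord) a-d b-d a<b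
... | c , c≤b , l , r , sub , a∈l = c , c≤b , l , r , right sub , a∈l

lemma2 : (T A : Tree) (s a b : ℕ) →
    IsBST T → s ∈T T →
    IsBST A → inorder A ↭ path s T → RootIs s A →
    a ∈ path s T → b ∈ path s T → s < a → a < b →
    (∃ λ U → SubAt b T U × a ∈T U) →
    Monotone s A (a ∷ b ∷ []) →
    ∀ U U' → SubAt b T U → SubAt a (after s T A) U' →
    ∀ x → x ∈T U' → x ∈T U
-- The second alternative of monotonicity (both keys below s) contradicts s < a.
lemma2 _ _ _ _ _ _ _ _ _ _ _ _ s<a _ _ (inj₂ ((a<s ∷ _) , _)) _ _ _ _ _ _ =
  ⊥-elim (<-asym s<a a<s)
lemma2 T A@(node _ s _) s a b bst-T s∈T bst-A A↭P root _ b∈P s<a a<b _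
       (inj₁ (_ , _ , a-d ∷ b-d ∷ _)) _ _ T-b T'-a x x∈T'a =
  subtree-convex ord-T T-b (search-path-subtree ord-T s∈T b∈P T-b) x∈T s<x x<b
  where
    T' : Tree
    T' = after s T A

    ord-T : Ordered T
    ord-T = IsBST⇒Ordered bst-T

    ord-A : Ordered A
    ord-A = IsBST⇒Ordered bst-A

    same-keys : inorder T' ≡ inorder T
    same-keys = after-inorder s T A ord-T ord-A A↭P

    ord-T' : Ordered T'
    ord-T' = ordered (subst (AllPairs _<_) (sym same-keys) (Ordered.increasing ord-T))

    A⊑T' : A ⊑ T'
    A⊑T' = fill-⊑ A (hang s T)

    x∈T : x ∈T T
    x∈T = ∈inorder⇒∈T T (subst (x ∈_) same-keys (∈T⇒∈inorder (subtree-⊆ T'-a x∈T'a)))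

    -- a lies right of the root s of A, hence of T'.
    s<x : s < x
    s<x with ⊑-subtree A⊑T' here
    ... | _ , _ , T'-s , _ , r⊑ = right-descendant-above ord-T' T'-s
            (⊑-∈ r⊑ (descend-right ord-A (rdepth-∈ a-d) s<a)) T'-a x∈T'a

    -- a lies left of the lowest common ancestor c ≤ b of a and b, in A and in T'.
    x<b : x < b
    x<b with same-right-depth ord-A a-d b-d a<b
    ... | _ , c≤b , _ , _ , A-c , a∈l with ⊑-subtree A⊑T' A-c
    ... | _ , _ , T'-c , l⊑ , _ =
      <-≤-trans (left-descendant-below ord-T' T'-c (⊑-∈ l⊑ a∈l) T'-a x∈T'a) c≤b
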